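{- Let $G$ be a connected graph with vertex set $\{1,\dots,n\}$, $n\ge 2$, let $\Phi=(F_1,\dots,F_n)$ be an $n$-tuple of pairwise disjoint graphs, and let $G[\Phi]$ be the generalized lexicographic product. If $\gamma(F_1)=\gamma(F_2)=\dots=\gamma(F_n)=1$, then $\gamma(G)=\gamma(G[\Phi])$.
   Context: All graphs are finite, simple and undirected. The generalized lexicographic product $G[\Phi]$ is the graph with vertex set $\bigcup_{i=1}^n V(F_i)$ in which each $F_i$ is an induced subgraph, and for $x\in V(F_i)$, $y\in V(F_j)$ with $i\neq j$, $xy$ is an edge iff $ij\in E(G)$. $\gamma(H)$ denotes the domination number of $H$ (minimum size of a set $D$ such that every vertex outside $D$ has a neighbor in $D$). -}

module Defs where

open import Data.Nat using (ℕ; _≤_)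
open import Data.Fin using (Fin)
open import Data.List using (List; length)
open import Data.List.Membership.Propositional using (_∈_)
open import Data.Product using (Σ; ∃; _×_; _,_)
open import Data.Sum using (_⊎_; inj₁; inj₂)
open import Relation.Nullary using (¬_)
open import Relation.Binary.PropositionalEquality using (_≡_; _≢_; refl)
open import Function using (_⇔_)

record Graph (V : Set) : Set₁ where
  field
    Adj    : V → V → Set
    sym    : ∀ {x y} → Adj x y → Adj y x
    irrefl : ∀ x → ¬ Adj x x
open Graph public

data Reach {V : Set} (G : Graph V) : V → V → Set where
  here : ∀ {x} → Reach G x x
  step : ∀ {x y z} → Adj G x y → Reach G y z → Reach G x z

Connected : {V : Set} → Graph V → Set
Connected G = ∀ x y → Reach G x y

Dominating : {V : Set} → Graph V → List V → Set
Dominating G D = ∀ v → v ∈ D ⊎ Σ _ (λ u → u ∈ D × Adj G u v)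

-- γ(G) = k : some dominating set has size k, and every dominating set has size ≥ k.
-- (Lists may repeat vertices, which does not change the minimum.)
IsDomNum : {V : Set} → Graph V → ℕ → Set
IsDomNum {V} G k =
  Σ (List V) (λ D → length D ≡ k × Dominating G D)
  × (∀ (D : List V) → Dominating G D → k ≤ length D)

LexV : (n : ℕ) → (Fin n → ℕ) → Set
LexV n m = Σ (Fin n) (λ i → Fin (m i))

data LexAdj {n : ℕ} {m : Fin n → ℕ} (G : Graph (Fin n))
            (F : (i : Fin n) → Graph (Fin (m i))) : LexV n m → LexV n m → Set where
  inner : ∀ {i x y} → Adj (F i) x y → LexAdj G F (i , x) (i , y)
  outer : ∀ {i j x y} → i ≢ j → Adj G i j → LexAdj G F (i , x) (j , y)

private
  lexSym : ∀ {n} {m : Fin n → ℕ} {G : Graph (Fin n)} {F : (i : Fin n) → Graph (Fin (m i))}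
           {a b} → LexAdj G F a b → LexAdj G F b a
  lexSym {F = F} (inner {i} p) = inner (sym (F i) p)
  lexSym {G = G} (outer ne p) = outer (λ e → ne (symEq e)) (sym G p)
    where
      symEq : ∀ {A : Set} {a b : A} → a ≡ b → b ≡ a
      symEq refl = refl

  lexIrr : ∀ {n} {m : Fin n → ℕ} {G : Graph (Fin n)} {F : (i : Fin n) → Graph (Fin (m i))}
           a → ¬ LexAdj G F a a
  lexIrr {F = F} (i , x) (inner p) = irrefl (F i) x p
  lexIrr (i , x) (outer ne p) = ne refl

Lex : {n : ℕ} {m : Fin n → ℕ} → Graph (Fin n)
      → ((i : Fin n) → Graph (Fin (m i))) → Graph (LexV n m)
Lex {n} {m} G F = record { Adj = LexAdj G F ; sym = lexSym {n} {m} ; irrefl = lexIrr {n} {m} }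

module Submission where

-- Each F i has a vertex c i adjacent to all others, so the vertices (i , c i) form a copy of G
-- inside G[Φ]. A dominating set D of G lifts to {(i , c i) | i ∈ D}: a vertex (j , y) is dominated
-- through the outer edge from a neighbour of j in D, or, when j ∈ D, by (j , c j) itself.
-- Conversely, projecting a dominating set of G[Φ] to its indices dominates G, as one sees by
-- looking at who dominates (j , c j). Both maps preserve lengths of lists, so the minima agree.

open import Defs
open import Data.Nat using (ℕ; _≤_)
open import Data.Nat.Properties using (≤-trans; ≤-reflexive)
open import Data.Fin using (Fin)
open import Data.List using ([]; _∷_; [_]; map)
open import Data.List.Properties using (length-map)
open import Data.List.Membership.Propositional.Properties using (∈-map⁺)
open import Data.List.Relation.Unary.Any using (here)
open import Data.Product using (Σ; _,_; proj₁; proj₂)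
open import Data.Sum using (_⊎_; inj₁; inj₂)
open import Function using (_⇔_; mk⇔)
open import Relation.Binary.PropositionalEquality using (_≡_; refl; trans)

record PreservesDomination {V W : Set} (G : Graph V) (H : Graph W) (φ : V → W) : Set where
  field
    map-dominating : ∀ D → Dominating G D → Dominating H (map φ D)
open PreservesDomination

IsDomNum-transfer : {V W : Set} {G : Graph V} {H : Graph W} {φ : V → W} {ψ : W → V}
  → PreservesDomination G H φ → PreservesDomination H G ψ
  → ∀ k → IsDomNum G k → IsDomNum H k
IsDomNum-transfer {φ = φ} {ψ} φ-dom ψ-dom k ((D , |D|≡k , D-dom) , minimal) =
  (map φ D , trans (length-map φ D) |D|≡k , map-dominating φ-dom D D-dom) ,
  λ E E-dom → ≤-trans (minimal (map ψ E) (map-dominating ψ-dom E E-dom)) (≤-reflexive (length-map ψ E))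

IsDomNum-⇔ : {V W : Set} {G : Graph V} {H : Graph W} {φ : V → W} {ψ : W → V}
  → PreservesDomination G H φ → PreservesDomination H G ψ
  → ∀ k → IsDomNum G k ⇔ IsDomNum H k
IsDomNum-⇔ φ-dom ψ-dom k =
  mk⇔ (IsDomNum-transfer φ-dom ψ-dom k) (IsDomNum-transfer ψ-dom φ-dom k)

IsDomNum-1⇒dominatingVertex : {V : Set} (H : Graph V) → IsDomNum H 1 → Σ V (λ c → Dominating H [ c ])
IsDomNum-1⇒dominatingVertex H ((c ∷ [] , refl , c-dom) , _) = c , c-dom

module _ {n : ℕ} {m : Fin n → ℕ} (G : Graph (Fin n)) (F : (i : Fin n) → Graph (Fin (m i))) where

  Lex-outer : ∀ {i j x y} → Adj G i j → Adj (Lex G F) (i , x) (j , y)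
  Lex-outer {i} i~j = outer (λ { refl → irrefl G i i~j }) i~j

  project-dominating : (c : (i : Fin n) → Fin (m i)) → PreservesDomination (Lex G F) G proj₁
  project-dominating c .map-dominating D D-dom j with D-dom (j , c j)
  ... | inj₁ jc∈D = inj₁ (∈-map⁺ proj₁ jc∈D)
  ... | inj₂ (_ , p∈D , inner _) = inj₁ (∈-map⁺ proj₁ p∈D)
  ... | inj₂ ((i , _) , p∈D , outer _ i~j) = inj₂ (i , ∈-map⁺ proj₁ p∈D , i~j)

  module _ (c : (i : Fin n) → Fin (m i)) (c-dom : ∀ i → Dominating (F i) [ c i ]) where

    centre : Fin n → LexV n m
    centre i = i , c i

    centre-dominatesFibre : ∀ j y → (j , y) ≡ centre j ⊎ Adj (Lex G F) (centre j) (j , y)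
    centre-dominatesFibre j y with c-dom j y
    ... | inj₁ (here refl) = inj₁ refl
    ... | inj₂ (_ , here refl , cj~y) = inj₂ (inner cj~y)

    lift-dominating : PreservesDomination G (Lex G F) centre
    lift-dominating .map-dominating D D-dom (j , y) with D-dom j
    ... | inj₂ (i , i∈D , i~j) = inj₂ (centre i , ∈-map⁺ centre i∈D , Lex-outer i~j)
    ... | inj₁ j∈D with centre-dominatesFibre j y
    ...   | inj₁ refl = inj₁ (∈-map⁺ centre j∈D)
    ...   | inj₂ cj~y = inj₂ (centre j , ∈-map⁺ centre j∈D , cj~y)

corollary2p3 : (n : ℕ) → 2 ≤ n → (G : Graph (Fin n)) → Connected G
    → (m : Fin n → ℕ) → (F : (i : Fin n) → Graph (Fin (m i)))
    → (∀ i → IsDomNum (F i) 1)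
    → ∀ k → IsDomNum G k ⇔ IsDomNum (Lex G F) k
corollary2p3 n _ G _ m F γF≡1 =
  IsDomNum-⇔ (lift-dominating G F c c-dom) (project-dominating G F c)
  where
    c : (i : Fin n) → Fin (m i)
    c i = proj₁ (IsDomNum-1⇒dominatingVertex (F i) (γF≡1 i))

    c-dom : ∀ i → Dominating (F i) [ c i ]
    c-dom i = proj₂ (IsDomNum-1⇒dominatingVertex (F i) (γF≡1 i))
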